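{- Let $H=(V,E)$ be a connected simple graph with at least one edge, and let $k\geq 3$ and $s$ be integers with $1\leq s<\frac{k}{2}$. Let $H^{k,s}$ be the generalized power hypergraph obtained from $H$. Then $\gamma(H^{k,s})=\nu(H^{k,s})$ if and only if $H$ is a König–Egerváry graph, i.e. $\tau(H)=\nu(H)$.
   Context: Generalized power hypergraph: given a simple graph $H=(V,E)$ and integers $k\geq 3$, $1\leq s\leq k/2$, the hypergraph $H^{k,s}$ is the $k$-uniform hypergraph whose vertex set is $\{\mathbf{v}: v\in V\}\cup\{\mathbf{e}: e\in E\}$. Here each $\mathbf{v}$ is an $s$-set containing $v$, each $\mathbf{e}$ is a $(k-2s)$-set, and all these sets are pairwise disjoint. The vertex set of $H^{k,s}$ is the union of these sets. The edge set of $H^{k,s}$ is $\{\mathbf{u}\cup\mathbf{v}\cup\mathbf{e} : e=\{u,v\}\in E\}$. For a hypergraph (or graph) $G$: - Two vertices are adjacent if some edge contains both. - A set $D$ of vertices is dominating if every vertex not in $D$ is adjacent to some vertex of $D$. $\gamma(G)$ is the minimum size of a dominating set. - $\nu(G)$ is the maximum number of pairwise disjoint edges (the matching number). - $\tau(G)$ is the minimum size of a vertex set meeting every edge (the transversal number). A graph $H$ with $\tau(H)=\nu(H)$ is called a König–Egerváry graph. -}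

module Defs where

open import Data.Nat using (ℕ; _+_; _*_; _∸_; _≤_)
open import Data.Fin using (Fin; splitAt; remQuot; _≟_)
open import Data.Fin.Subset using (Subset; _∈_; ∣_∣)
open import Data.Vec using (lookup; tabulate)
open import Data.Sum using (inj₁; inj₂)
open import Data.Product using (Σ; _×_; ∃-syntax; proj₁)
open import Relation.Nullary using (¬_)
open import Relation.Nullary.Decidable using (⌊_⌋)
open import Relation.Binary.PropositionalEquality using (_≡_; _≢_)
open import Relation.Binary.Construct.Closure.ReflexiveTransitive using (Star)

record Hypergraph : Set where
  constructor hyp
  field
    nV   : ℕ
    nE   : ℕ
    edge : Fin nE → Subset nV
open Hypergraph public

module _ (G : Hypergraph) where

  Adjacent : Fin (nV G) → Fin (nV G) → Set
  Adjacent u v = ∃[ i ] (u ∈ edge G i × v ∈ edge G i)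

  IsDominating : Subset (nV G) → Set
  IsDominating D = ∀ v → ¬ (v ∈ D) → ∃[ u ] (u ∈ D × Adjacent u v)

  IsMatching : Subset (nE G) → Set
  IsMatching M = ∀ i j → i ∈ M → j ∈ M → i ≢ j →
                 ∀ v → v ∈ edge G i → ¬ (v ∈ edge G j)

  IsTransversal : Subset (nV G) → Set
  IsTransversal T = ∀ i → ∃[ v ] (v ∈ T × v ∈ edge G i)

  IsDominationNumber : ℕ → Set
  IsDominationNumber d =
    (∃[ D ] (IsDominating D × ∣ D ∣ ≡ d)) × (∀ D → IsDominating D → d ≤ ∣ D ∣)

  IsMatchingNumber : ℕ → Set
  IsMatchingNumber d =
    (∃[ M ] (IsMatching M × ∣ M ∣ ≡ d)) × (∀ M → IsMatching M → ∣ M ∣ ≤ d)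

  IsTransversalNumber : ℕ → Set
  IsTransversalNumber d =
    (∃[ T ] (IsTransversal T × ∣ T ∣ ≡ d)) × (∀ T → IsTransversal T → d ≤ ∣ T ∣)

  IsSimpleGraph : Set
  IsSimpleGraph = (∀ i → ∣ edge G i ∣ ≡ 2) × (∀ i j → edge G i ≡ edge G j → i ≡ j)

  IsConnected : Set
  IsConnected = ∀ u v → Star Adjacent u v

-- Vertices: Fin (nV*s + nE*(k-2s)); the first block is split by remQuot into
-- the s-sets 𝐯 (one per vertex v of H), the second block into the
-- (k-2s)-sets 𝐞 (one per edge e of H).  The hyperedge for e is the union of
-- 𝐯 over v ∈ e together with 𝐞.
powerEdge : (k s : ℕ) (H : Hypergraph) → Fin (nE H) →
            Subset (nV H * s + nE H * (k ∸ 2 * s))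
powerEdge k s H i = tabulate f
  where
  f : Fin (nV H * s + nE H * (k ∸ 2 * s)) → _
  f x with splitAt (nV H * s) x
  ... | inj₁ y = lookup (edge H i) (proj₁ (remQuot s y))
  ... | inj₂ z = ⌊ proj₁ (remQuot (k ∸ 2 * s) z) ≟ i ⌋

power : (k s : ℕ) → Hypergraph → Hypergraph
power k s H = hyp (nV H * s + nE H * (k ∸ 2 * s)) (nE H) (powerEdge k s H)

{-# OPTIONS --safe #-}
module Submission where

-- Let G = H^{k,s}. Collapsing each 𝐯 to v and each 𝐞 to an endpoint of e maps
-- G onto H edge by edge, and picking one vertex of each 𝐯 embeds H into G edge
-- by edge. Both maps carry transversals to transversals (by taking images, which
-- does not increase size) and matchings to matchings (edge indices are shared),
-- so τ(G) = τ(H) and ν(G) = ν(H). Since k > 2s, each edge of G owns the vertices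
-- of its 𝐞, which lie in no other edge; and since H is connected with an edge,
-- no vertex of G is isolated. In such a hypergraph a set is dominating exactly
-- when it meets every edge, hence γ(G) = τ(G) = τ(H).

open import Defs
open import Data.Bool.Properties using (T-≡)
open import Data.Empty using (⊥-elim)
open import Data.Fin using (Fin; zero; suc; fromℕ<; _↑ˡ_; _↑ʳ_; combine; remQuot; splitAt; _≟_)
open import Data.Fin.Properties
  using (splitAt-↑ˡ; splitAt-↑ʳ; splitAt⁻¹-↑ˡ; splitAt⁻¹-↑ʳ; remQuot-combine; combine-remQuot)
open import Data.Fin.Subset using (Subset; _∈_; ∣_∣; ⊥; ⁅_⁆; _∪_; Nonempty; inside; outside)
open import Data.Fin.Subset.Properties
  using (_∈?_; ∣⊥∣≡0; ∣⁅x⁆∣≡1; x∈⁅x⁆; x∈p∪q⁺; nonempty?; Empty-unique)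
open import Data.Nat using (ℕ; suc; _+_; _*_; _∸_; _≤_; _<_; z≤n; s≤s)
open import Data.Nat.Properties
  using (≤-refl; ≤-trans; ≤-antisym; <-irrefl; +-suc; m≤n⇒m≤1+n; m<n⇒0<n∸m)
open import Data.Product using (_×_; _,_; proj₁; proj₂; ∃-syntax)
open import Data.Product.Function.Dependent.Propositional using (congˡ)
open import Data.Product.Function.NonDependent.Propositional using (_×-⇔_)
open import Data.Sum using (inj₁; inj₂; [_,_]′)
open import Data.Vec using (Vec; _∷_; []; lookup; tabulate; here; there)
open import Data.Vec.Properties using (lookup∘tabulate; []=⇒lookup; lookup⇒[]=)
open import Function using (id; _∘_)
open import Function.Bundles using (_⇔_; mk⇔; Equivalence)
import Function.Properties.Equivalence as ⇔
open import Function.Related.Propositional using (equivalence)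
open import Relation.Nullary using (yes; no)
open import Relation.Nullary.Decidable using (⌊_⌋; toWitness; fromWitness)
open import Relation.Binary.PropositionalEquality using (_≡_; refl; sym; trans; cong; subst)
open import Relation.Binary.Construct.Closure.ReflexiveTransitive using (ε; _◅_)

∣p∪q∣≤∣p∣+∣q∣ : ∀ {n} (p q : Subset n) → ∣ p ∪ q ∣ ≤ ∣ p ∣ + ∣ q ∣
∣p∪q∣≤∣p∣+∣q∣ []            []            = z≤n
∣p∪q∣≤∣p∣+∣q∣ (inside  ∷ p) (inside  ∷ q) =
  s≤s (subst (∣ p ∪ q ∣ ≤_) (sym (+-suc ∣ p ∣ ∣ q ∣)) (m≤n⇒m≤1+n (∣p∪q∣≤∣p∣+∣q∣ p q)))
∣p∪q∣≤∣p∣+∣q∣ (inside  ∷ p) (outside ∷ q) = s≤s (∣p∪q∣≤∣p∣+∣q∣ p q)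
∣p∪q∣≤∣p∣+∣q∣ (outside ∷ p) (inside  ∷ q) =
  subst (suc ∣ p ∪ q ∣ ≤_) (sym (+-suc ∣ p ∣ ∣ q ∣)) (s≤s (∣p∪q∣≤∣p∣+∣q∣ p q))
∣p∪q∣≤∣p∣+∣q∣ (outside ∷ p) (outside ∷ q) = ∣p∪q∣≤∣p∣+∣q∣ p q

∣p∣>0⇒Nonempty : ∀ {n} (p : Subset n) → 0 < ∣ p ∣ → Nonempty p
∣p∣>0⇒Nonempty {n} p 0<∣p∣ with nonempty? p
... | yes p≢∅ = p≢∅
... | no  p≡∅ =
  ⊥-elim (<-irrefl (sym (∣⊥∣≡0 n)) (subst (λ q → 0 < ∣ q ∣) (Empty-unique p≡∅) 0<∣p∣))

∈-transport : ∀ {a b} {p : Subset a} {q : Subset b} {x y} →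
              lookup p x ≡ lookup q y → x ∈ p → y ∈ q
∈-transport {q = q} {y = y} eq x∈p = lookup⇒[]= y q (trans (sym eq) ([]=⇒lookup x∈p))

image : ∀ {a b} → (Fin a → Fin b) → Subset a → Subset b
image f []            = ⊥
image f (outside ∷ p) = image (f ∘ suc) p
image f (inside  ∷ p) = ⁅ f zero ⁆ ∪ image (f ∘ suc) p

∈-image : ∀ {a b} (f : Fin a → Fin b) (p : Subset a) {x} → x ∈ p → f x ∈ image f p
∈-image f (inside  ∷ p) here        = x∈p∪q⁺ (inj₁ (x∈⁅x⁆ (f zero)))
∈-image f (inside  ∷ p) (there x∈p) =
  x∈p∪q⁺ {p = ⁅ f zero ⁆} (inj₂ (∈-image (f ∘ suc) p x∈p))
∈-image f (outside ∷ p) (there x∈p) = ∈-image (f ∘ suc) p x∈p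

∣image∣≤∣p∣ : ∀ {a b} (f : Fin a → Fin b) (p : Subset a) → ∣ image f p ∣ ≤ ∣ p ∣
∣image∣≤∣p∣ {b = b} f []  = subst (_≤ 0) (sym (∣⊥∣≡0 b)) z≤n
∣image∣≤∣p∣ f (outside ∷ p) = ∣image∣≤∣p∣ (f ∘ suc) p
∣image∣≤∣p∣ f (inside  ∷ p) = ≤-trans (∣p∪q∣≤∣p∣+∣q∣ ⁅ f zero ⁆ (image (f ∘ suc) p))
  (subst (λ c → c + ∣ image (f ∘ suc) p ∣ ≤ suc ∣ p ∣) (sym (∣⁅x⁆∣≡1 (f zero)))
         (s≤s (∣image∣≤∣p∣ (f ∘ suc) p)))

-- IsDominationNumber, IsTransversalNumber and IsMatchingNumber unfold to these.
IsMinimum : ∀ {n} → (Subset n → Set) → ℕ → Set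
IsMinimum P d = (∃[ X ] (P X × ∣ X ∣ ≡ d)) × (∀ X → P X → d ≤ ∣ X ∣)

IsMaximum : ∀ {n} → (Subset n → Set) → ℕ → Set
IsMaximum P d = (∃[ X ] (P X × ∣ X ∣ ≡ d)) × (∀ X → P X → ∣ X ∣ ≤ d)

IsMinimum-transfer : ∀ {a b} {P : Subset a → Set} {Q : Subset b → Set}
                     (φ : Subset a → Subset b) (ψ : Subset b → Subset a) →
                     (∀ X → ∣ φ X ∣ ≤ ∣ X ∣) → (∀ Y → ∣ ψ Y ∣ ≤ ∣ Y ∣) →
                     (∀ X → P X → Q (φ X)) → (∀ Y → Q Y → P (ψ Y)) →
                     ∀ {d} → IsMinimum P d → IsMinimum Q d
IsMinimum-transfer {Q = Q} φ ψ φ≤ ψ≤ P⇒Qφ Q⇒Pψ {d} ((X , PX , ∣X∣≡d) , minimal) =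
  (φ X , QφX , ≤-antisym ∣φX∣≤d (lower (φ X) QφX)) , lower
  where
  QφX : Q (φ X)
  QφX = P⇒Qφ X PX
  ∣φX∣≤d : ∣ φ X ∣ ≤ d
  ∣φX∣≤d = subst (∣ φ X ∣ ≤_) ∣X∣≡d (φ≤ X)
  lower : ∀ Y → Q Y → d ≤ ∣ Y ∣
  lower Y QY = ≤-trans (minimal (ψ Y) (Q⇒Pψ Y QY)) (ψ≤ Y)

IsMinimum-⇔ : ∀ {a b} {P : Subset a → Set} {Q : Subset b → Set}
              (φ : Subset a → Subset b) (ψ : Subset b → Subset a) →
              (∀ X → ∣ φ X ∣ ≤ ∣ X ∣) → (∀ Y → ∣ ψ Y ∣ ≤ ∣ Y ∣) →
              (∀ X → P X → Q (φ X)) → (∀ Y → Q Y → P (ψ Y)) →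
              ∀ {d} → IsMinimum P d ⇔ IsMinimum Q d
IsMinimum-⇔ φ ψ φ≤ ψ≤ P⇒Qφ Q⇒Pψ =
  mk⇔ (IsMinimum-transfer φ ψ φ≤ ψ≤ P⇒Qφ Q⇒Pψ) (IsMinimum-transfer ψ φ ψ≤ φ≤ Q⇒Pψ P⇒Qφ)

IsMaximum-⇔ : ∀ {n} {P Q : Subset n → Set} → (∀ X → P X → Q X) → (∀ X → Q X → P X) →
              ∀ {d} → IsMaximum P d ⇔ IsMaximum Q d
IsMaximum-⇔ P⇒Q Q⇒P = mk⇔
  (λ { ((X , PX , ∣X∣≡d) , maximal) → (X , P⇒Q X PX , ∣X∣≡d) , λ Y → maximal Y ∘ Q⇒P Y })
  (λ { ((X , QX , ∣X∣≡d) , maximal) → (X , Q⇒P X QX , ∣X∣≡d) , λ Y → maximal Y ∘ P⇒Q Y })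

HasNoIsolatedVertex : Hypergraph → Set
HasNoIsolatedVertex G = ∀ v → ∃[ i ] (v ∈ edge G i)

HasPrivateVertices : Hypergraph → Set
HasPrivateVertices G = ∀ i → ∃[ x ] (x ∈ edge G i × ∀ j → x ∈ edge G j → j ≡ i)

module _ (G : Hypergraph) where

  connected⇒noIsolatedVertex : IsConnected G → ∀ i → Nonempty (edge G i) → HasNoIsolatedVertex G
  connected⇒noIsolatedVertex connected i (w , w∈i) v with connected v w
  ... | ε                 = i , w∈i
  ... | (j , v∈j , _) ◅ _ = j , v∈j

  transversal⇒dominating : HasNoIsolatedVertex G → ∀ T → IsTransversal G T → IsDominating G T
  transversal⇒dominating noIsolated T transversal v _ with noIsolated v
  ... | i , v∈i with transversal i
  ... | u , u∈T , u∈i = u , u∈T , i , u∈i , v∈i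

  dominating⇒transversal : HasPrivateVertices G → ∀ D → IsDominating G D → IsTransversal G D
  dominating⇒transversal privateVertex D dominating i with privateVertex i
  ... | x , x∈i , onlyIn-i with x ∈? D
  ... | yes x∈D = x , x∈D , x∈i
  ... | no  x∉D with dominating x x∉D
  ... | u , u∈D , j , u∈j , x∈j with refl ← onlyIn-i j x∈j = u , u∈D , u∈j

  dominationNumber⇔transversalNumber : HasNoIsolatedVertex G → HasPrivateVertices G →
    ∀ {d} → IsDominationNumber G d ⇔ IsTransversalNumber G d
  dominationNumber⇔transversalNumber noIsolated privateVertex =
    IsMinimum-⇔ id id (λ _ → ≤-refl) (λ _ → ≤-refl)
      (dominating⇒transversal privateVertex) (transversal⇒dominating noIsolated)

-- Hypergraphs sharing an edge index set are compared through their edge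
-- families: a Hypergraph G is definitionally hyp (nV G) (nE G) (edge G), and
-- power k s H has the edge indices of H.
EdgePreserving : ∀ {a b m} → (Fin m → Subset a) → (Fin m → Subset b) → (Fin a → Fin b) → Set
EdgePreserving e e′ f = ∀ i {x} → x ∈ e i → f x ∈ e′ i

transversal-image : ∀ {a b m} {e : Fin m → Subset a} {e′ : Fin m → Subset b} f →
  EdgePreserving e e′ f → ∀ T → IsTransversal (hyp a m e) T → IsTransversal (hyp b m e′) (image f T)
transversal-image f preserves T transversal i with transversal i
... | x , x∈T , x∈i = f x , ∈-image f T x∈T , preserves i x∈i

matching-preimage : ∀ {a b m} {e : Fin m → Subset a} {e′ : Fin m → Subset b} f →
  EdgePreserving e e′ f → ∀ M → IsMatching (hyp b m e′) M → IsMatching (hyp a m e) M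
matching-preimage f preserves M matching i j i∈M j∈M i≢j x x∈i x∈j =
  matching i j i∈M j∈M i≢j (f x) (preserves i x∈i) (preserves j x∈j)

module _ {a b m} {e : Fin m → Subset a} {e′ : Fin m → Subset b}
         (f : Fin a → Fin b) (g : Fin b → Fin a)
         (f-preserves : EdgePreserving e e′ f) (g-preserves : EdgePreserving e′ e g) where

  transversalNumber-⇔ : ∀ {d} → IsTransversalNumber (hyp a m e) d ⇔ IsTransversalNumber (hyp b m e′) d
  transversalNumber-⇔ = IsMinimum-⇔ (image f) (image g) (∣image∣≤∣p∣ f) (∣image∣≤∣p∣ g)
    (transversal-image f f-preserves) (transversal-image g g-preserves)

  matchingNumber-⇔ : ∀ {d} → IsMatchingNumber (hyp a m e) d ⇔ IsMatchingNumber (hyp b m e′) d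
  matchingNumber-⇔ = IsMaximum-⇔ (matching-preimage g g-preserves) (matching-preimage f f-preserves)

-- powerEdge tabulates a function local to its definition, which can only be
-- named through unification with the vector itself.
lookup-≡tabulate : ∀ {n} {A : Set} {f : Fin n → A} {xs : Vec A n} → xs ≡ tabulate f →
                   ∀ i → lookup xs i ≡ f i
lookup-≡tabulate refl = lookup∘tabulate _

module PowerHypergraph (k s : ℕ) (H : Hypergraph) where

  private
    r = k ∸ 2 * s
    N = nV H * s + nE H * r

  -- vertexCopy v j and edgeCopy e j are the j-th vertices of the sets 𝐯 and 𝐞.
  vertexCopy : Fin (nV H) → Fin s → Fin N
  vertexCopy v j = combine v j ↑ˡ (nE H * r)

  edgeCopy : Fin (nE H) → Fin r → Fin N
  edgeCopy e j = (nV H * s) ↑ʳ combine e j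

  lookup-vertexCopy : ∀ i v j → lookup (powerEdge k s H i) (vertexCopy v j) ≡ lookup (edge H i) v
  lookup-vertexCopy i v j
    rewrite lookup-≡tabulate {xs = powerEdge k s H i} refl (vertexCopy v j)
          | splitAt-↑ˡ (nV H * s) (combine v j) (nE H * r)
          = cong (lookup (edge H i) ∘ proj₁) (remQuot-combine v j)

  lookup-edgeCopy : ∀ i e j → lookup (powerEdge k s H i) (edgeCopy e j) ≡ ⌊ e ≟ i ⌋
  lookup-edgeCopy i e j
    rewrite lookup-≡tabulate {xs = powerEdge k s H i} refl (edgeCopy e j)
          | splitAt-↑ʳ (nV H * s) (nE H * r) (combine e j)
          = cong (λ q → ⌊ proj₁ q ≟ i ⌋) (remQuot-combine e j)

  data Copy : Fin N → Set where
    ofVertex : ∀ v j → Copy (vertexCopy v j)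
    ofEdge   : ∀ e j → Copy (edgeCopy e j)

  copy : ∀ x → Copy x
  copy x with splitAt (nV H * s) x in eq
  ... | inj₁ y = subst Copy
                   (trans (cong (_↑ˡ (nE H * r)) (combine-remQuot {nV H} s y)) (splitAt⁻¹-↑ˡ eq))
                   (ofVertex (proj₁ (remQuot {nV H} s y)) (proj₂ (remQuot {nV H} s y)))
  ... | inj₂ z = subst Copy
                   (trans (cong ((nV H * s) ↑ʳ_) (combine-remQuot {nE H} r z)) (splitAt⁻¹-↑ʳ eq))
                   (ofEdge (proj₁ (remQuot {nE H} r z)) (proj₂ (remQuot {nE H} r z)))

  edgeCopy∈ : ∀ e j → edgeCopy e j ∈ powerEdge k s H e
  edgeCopy∈ e j = lookup⇒[]= (edgeCopy e j) (powerEdge k s H e)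
    (trans (lookup-edgeCopy e e j) (Equivalence.to T-≡ (fromWitness refl)))

  edgeCopy∈⇒≡ : ∀ {i e j} → edgeCopy e j ∈ powerEdge k s H i → e ≡ i
  edgeCopy∈⇒≡ {i} {e} {j} x∈i =
    toWitness (Equivalence.from T-≡ (trans (sym (lookup-edgeCopy i e j)) ([]=⇒lookup x∈i)))

  vertexCopy-preserves : ∀ j → EdgePreserving (edge H) (powerEdge k s H) (λ v → vertexCopy v j)
  vertexCopy-preserves j i v∈i = ∈-transport (sym (lookup-vertexCopy i _ j)) v∈i

  privateVertices : Fin r → HasPrivateVertices (power k s H)
  privateVertices j i = edgeCopy i j , edgeCopy∈ i j , λ _ x∈ → sym (edgeCopy∈⇒≡ x∈)

  noIsolatedVertex : HasNoIsolatedVertex H → HasNoIsolatedVertex (power k s H)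
  noIsolatedVertex noIsolated x with copy x
  ... | ofEdge e j = e , edgeCopy∈ e j
  ... | ofVertex v j with noIsolated v
  ... | i , v∈i = i , vertexCopy-preserves j i v∈i

  module _ (endpoint : ∀ e → Nonempty (edge H e)) where

    project : Fin N → Fin (nV H)
    project x =
      [ proj₁ ∘ remQuot s , proj₁ ∘ endpoint ∘ proj₁ ∘ remQuot r ]′ (splitAt (nV H * s) x)

    project-vertexCopy : ∀ v j → project (vertexCopy v j) ≡ v
    project-vertexCopy v j
      rewrite splitAt-↑ˡ (nV H * s) (combine v j) (nE H * r)
      = cong proj₁ (remQuot-combine v j)

    project-edgeCopy : ∀ e j → project (edgeCopy e j) ≡ proj₁ (endpoint e)
    project-edgeCopy e j
      rewrite splitAt-↑ʳ (nV H * s) (nE H * r) (combine e j)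
      = cong (proj₁ ∘ endpoint ∘ proj₁) (remQuot-combine e j)

    project-preserves : EdgePreserving (powerEdge k s H) (edge H) project
    project-preserves i {x} x∈i with copy x
    ... | ofVertex v j rewrite project-vertexCopy v j = ∈-transport (lookup-vertexCopy i v j) x∈i
    ... | ofEdge e j with refl ← edgeCopy∈⇒≡ x∈i rewrite project-edgeCopy e j = proj₂ (endpoint e)

mainTheorem1 : (H : Hypergraph) → IsSimpleGraph H → IsConnected H → 1 ≤ nE H →
    (k s : ℕ) → 3 ≤ k → 1 ≤ s → 2 * s < k →
    ((∃[ d ] (IsDominationNumber (power k s H) d × IsMatchingNumber (power k s H) d))
      ⇔ (∃[ t ] (IsTransversalNumber H t × IsMatchingNumber H t)))
mainTheorem1 H simple connected 1≤m k s _ 1≤s 2s<k =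
  congˡ {k = equivalence} (⇔.trans γ⇔τ τ⇔τ ×-⇔ ν⇔ν)
  where
  open PowerHypergraph k s H
  G : Hypergraph
  G = power k s H

  endpoint : ∀ e → Nonempty (edge H e)
  endpoint e = ∣p∣>0⇒Nonempty (edge H e) (subst (0 <_) (sym (proj₁ simple e)) (s≤s z≤n))

  embed : Fin (nV H) → Fin (nV G)
  embed v = vertexCopy v (fromℕ< 1≤s)

  noIsolatedH : HasNoIsolatedVertex H
  noIsolatedH = connected⇒noIsolatedVertex H connected (fromℕ< 1≤m) (endpoint (fromℕ< 1≤m))

  γ⇔τ : ∀ {d} → IsDominationNumber G d ⇔ IsTransversalNumber G d
  γ⇔τ = dominationNumber⇔transversalNumber G (noIsolatedVertex noIsolatedH)
          (privateVertices (fromℕ< (m<n⇒0<n∸m 2s<k)))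

  τ⇔τ : ∀ {d} → IsTransversalNumber G d ⇔ IsTransversalNumber H d
  τ⇔τ = transversalNumber-⇔ (project endpoint) embed (project-preserves endpoint) (vertexCopy-preserves (fromℕ< 1≤s))

  ν⇔ν : ∀ {d} → IsMatchingNumber G d ⇔ IsMatchingNumber H d
  ν⇔ν = matchingNumber-⇔ (project endpoint) embed (project-preserves endpoint) (vertexCopy-preserves (fromℕ< 1≤s))
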